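{- Let $G$ be a finite simple graph with vertices $v_1,\ldots,v_n$ and let $1\le m\le n$. Let $k_1=\cdots=k_m=2$, $k_{m+1}=\cdots=k_n=1$, and $\ell_{m+1}=\cdots=\ell_n=1$. With $p_1(x)=1+x$ and $p_0(x)=-x$, $$q(G[k_1,\ldots,k_n])=\sum_{\ell_1=0}^1\cdots\sum_{\ell_m=0}^1\Big\{q(G[\ell_1,\ldots,\ell_n])\prod_{i=1}^m p_{\ell_i}(x)\Big\}.$$
   Context: $G[k_1,\ldots,k_n]$ denotes the graph obtained from $G$ by replacing each $v_i$ with $k_i$ pairwise non-adjacent copies, each adjacent to all copies of $v_j$ for $v_iv_j\in E(G)$ (substitution of the edgeless graph $E_{k_i}$); when $k_i=0$ the vertex $v_i$ is deleted, so for $\ell_i\in\{0,1\}$, $G[\ell_1,\ldots,\ell_n]$ is the induced subgraph of $G$ on $\{v_i:\ell_i=1\}$. The interlace polynomial $q$ is the unique map from finite simple graphs to $\mathbb{Z}[x]$ with $q(E_n)=x^n$ for the edgeless graph $E_n$ on $n$ vertices and $q(G)=q(G-a)+q(G^{ab}-b)$ for every edge $ab$ of $G$; here the pivot $G^{ab}$ is obtained by partitioning the vertices other than $a,b$ into (1) adjacent to $a$ only, (2) adjacent to $b$ only, (3) adjacent to both, (4) adjacent to neither, and toggling the adjacency of every pair $\{x,y\}$ with $x,y$ in two different classes among (1),(2),(3). -}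

module Defs where

open import Data.Nat using (ℕ; zero; suc; _∸_)
open import Data.Integer using (ℤ; 0ℤ; 1ℤ; _+_; _*_; -_)
open import Data.Bool using (Bool; true; false; _∧_; _∨_; not; _xor_)
open import Data.Fin using (Fin; zero; suc; splitAt; punchIn)
open import Data.Fin using () renaming (_≟_ to _≟ᶠ_)
open import Data.Sum using (inj₁; inj₂)
open import Data.Vec using (Vec; []; _∷_; sum)
open import Data.List using (List; []; _∷_; foldr; map; upTo; concatMap)
open import Data.Product using (_×_)
open import Relation.Nullary.Decidable using (⌊_⌋)
open import Relation.Binary.PropositionalEquality using (_≡_)

-- Polynomials in ℤ[x], represented by their coefficient sequences
-- (coefficient of x^i at index i), compared coefficientwise.

Poly : Set
Poly = ℕ → ℤ

_≈_ : Poly → Poly → Set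
p ≈ q = ∀ i → p i ≡ q i
infix 4 _≈_

zeroP : Poly
zeroP _ = 0ℤ

oneP : Poly
oneP zero = 1ℤ
oneP (suc _) = 0ℤ

X^ : ℕ → Poly
X^ zero = oneP
X^ (suc n) zero = 0ℤ
X^ (suc n) (suc i) = X^ n i

_+P_ : Poly → Poly → Poly
(p +P q) i = p i + q i
infixl 6 _+P_

-P_ : Poly → Poly
(-P p) i = - p i

sumℤ : List ℤ → ℤ
sumℤ = foldr _+_ 0ℤ

_*P_ : Poly → Poly → Poly
(p *P q) i = sumℤ (map (λ j → p j * q (i ∸ j)) (upTo (suc i)))
infixl 7 _*P_

sumP : List Poly → Poly
sumP = foldr _+P_ zeroP

-- Finite simple graphs on vertex set Fin n (vertex v_{i+1} is index i),
-- given by an adjacency function.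

Adj : ℕ → Set
Adj n = Fin n → Fin n → Bool

Simple : ∀ {n} → Adj n → Set
Simple {n} G = (∀ i j → G i j ≡ G j i) × (∀ i → G i i ≡ false)

delete : ∀ {n} → Adj (suc n) → Fin (suc n) → Adj n
delete G a i j = G (punchIn a i) (punchIn a j)

_==_ : ∀ {n} → Fin n → Fin n → Bool
i == j = ⌊ i ≟ᶠ j ⌋

-- pivot G^{ab}: for x, y ∉ {a,b} lying in two different classes among
-- (1) adj. to a only, (2) adj. to b only, (3) adj. to both,
-- toggle the adjacency of x and y; everything else unchanged.
pivot : ∀ {n} → Adj n → Fin n → Fin n → Adj n
pivot G a b x y = G x y xor toggle
  where
  outside : _ → Bool
  outside z = not (z == a) ∧ not (z == b)
  inClass : _ → Bool
  inClass z = G a z ∨ G b z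
  differentClass : Bool
  differentClass = (G a x xor G a y) ∨ (G b x xor G b y)
  toggle : Bool
  toggle = outside x ∧ outside y ∧ inClass x ∧ inClass y ∧ differentClass

-- The interlace polynomial is the unique map q with q(E_n) = x^n and
-- q(G) = q(G - a) + q(G^{ab} - b) for every edge ab.  We characterise it by
-- these defining properties (on simple graphs).
IsInterlace : (∀ {n} → Adj n → Poly) → Set
IsInterlace Q =
  (∀ n (G : Adj n) → Simple G → (∀ i j → G i j ≡ false) → Q G ≈ X^ n)
  × (∀ n (G : Adj (suc n)) → Simple G → (a b : Fin (suc n)) → G a b ≡ true →
       Q G ≈ Q (delete G a) +P Q (delete (pivot G a b) b))

-- Substitution G[k_1,…,k_n]: vertex set Fin (k_1+⋯+k_n), the first k_1
-- vertices being the copies of v_1, the next k_2 those of v_2, etc.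

owner : ∀ {n} (k : Vec ℕ n) → Fin (sum k) → Fin n
owner (k₀ ∷ ks) j with splitAt k₀ j
... | inj₁ _ = zero
... | inj₂ j' = suc (owner ks j')

-- copies of v_i and v_j adjacent iff v_i v_j ∈ E(G); copies of the same
-- vertex are non-adjacent since G has no loops.
_[_] : ∀ {n} → Adj n → (k : Vec ℕ n) → Adj (sum k)
(G [ k ]) u w = G (owner k u) (owner k w)

allBools : (m : ℕ) → List (Vec Bool m)
allBools zero = [] ∷ []
allBools (suc m) = concatMap (λ v → (false ∷ v) ∷ (true ∷ v) ∷ []) (allBools m)

bitℕ : Bool → ℕ
bitℕ false = 0
bitℕ true = 1

pℓ : Bool → Poly
pℓ true = oneP +P X^ 1
pℓ false = -P X^ 1

prodPℓ : ∀ {m} → Vec Bool m → Poly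
prodPℓ [] = oneP
prodPℓ (b ∷ bs) = pℓ b *P prodPℓ bs

module Submission where

-- Doubling a vertex v of a graph H (adding a non-adjacent twin v′) gives
--   q(H with v doubled) = (1 + x) q(H) − x q(H − v).
-- If v is isolated, both sides reduce to x q(H) by the isolated-vertex rule q(K) = x q(K − v), itself a
-- consequence of the recursion. Otherwise pick a neighbour w and apply the recursion to the edge v′w:
-- deleting v′ leaves H, and after pivoting and deleting w the vertex v is isolated, with H^{vw} − w
-- remaining; comparing with the recursion for H on the edge vw gives the formula. Doubling the m
-- vertices one at a time and expanding (1 + x) q(…) − x q(… − v) yields the sum over ℓ, with weight
-- p₁ = 1 + x for keeping a vertex and p₀ = −x for deleting it. The relabellings this needs are
-- justified by the invariance of q under isomorphism, which follows by induction along the recursion.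

open import Defs
open import Data.Bool using (Bool; true; false; _∧_; _∨_; not; _xor_)
import Data.Bool as Bool
open import Data.Bool.Properties using (xor-comm; xor-same; ∧-zeroʳ; ¬-not)
open import Data.Fin using (Fin; zero; suc; punchIn; splitAt; _↑ˡ_; _↑ʳ_) renaming (_≟_ to _≟ᶠ_)
import Data.Fin.Properties as Fin
open import Data.Fin.Properties using (any?; splitAt-↑ˡ; splitAt-↑ʳ; splitAt⁻¹-↑ˡ; splitAt⁻¹-↑ʳ)
open import Data.Fin.Permutation
  using (Permutation; permutation; _⟨$⟩ʳ_; inverseʳ; remove; punchIn-permute; ↔⇒≡)
import Data.Fin.Permutation as Permutation
open import Data.Integer using (ℤ; 0ℤ; 1ℤ) renaming (_+_ to _+ℤ_; _*_ to _*ℤ_; -_ to -ℤ_)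
import Data.Integer.Properties as ℤ
open import Data.Integer.Tactic.RingSolver using (solve-∀)
open import Data.List using (List; []; _∷_; concatMap; applyUpTo) renaming (map to mapL)
open import Data.Nat using (ℕ; zero; suc; _+_; _∸_; _≤_; _<_; z≤n; s≤s)
import Data.Nat.Properties as ℕ
open import Data.Product using (_,_; ∃₂; proj₁; proj₂)
open import Data.Sum using (_⊎_; inj₁; inj₂; [_,_]′)
open import Data.Vec using (Vec; []; _∷_; sum; _++_; replicate; map)
open import Function using (_∘_)
open import Function.Bundles using (Injection)
open import Function.Properties.Inverse using (↔⇒↣)
open import Relation.Binary.Bundles using (Setoid)
open import Relation.Binary.PropositionalEquality hiding ([_])
import Relation.Binary.Reasoning.Setoid as SetoidReasoning
open import Relation.Nullary using (yes; no; contradiction)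
open import Relation.Nullary.Decidable using (isYes≗does; dec-true; dec-false)

open Setoid (ℕ →-setoid ℤ) using () renaming (refl to ≈-refl)
module ≈-Reasoning = SetoidReasoning (ℕ →-setoid ℤ)

-- Polynomial arithmetic

sumBelow : (ℕ → ℤ) → ℕ → ℤ
sumBelow g zero = 0ℤ
sumBelow g (suc n) = g 0 +ℤ sumBelow (g ∘ suc) n

sumℤ-applyUpTo : ∀ (g : ℕ → ℤ) f n → sumℤ (mapL g (applyUpTo f n)) ≡ sumBelow (g ∘ f) n
sumℤ-applyUpTo g f zero = refl
sumℤ-applyUpTo g f (suc n) = cong (g (f 0) +ℤ_) (sumℤ-applyUpTo g (f ∘ suc) n)

sumBelow-cong : ∀ n {g h : ℕ → ℤ} → (∀ j → j < n → g j ≡ h j) → sumBelow g n ≡ sumBelow h n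
sumBelow-cong zero e = refl
sumBelow-cong (suc n) e = cong₂ _+ℤ_ (e 0 (s≤s z≤n)) (sumBelow-cong n (λ j j<n → e (suc j) (s≤s j<n)))

sumBelow-0 : ∀ n → sumBelow (λ _ → 0ℤ) n ≡ 0ℤ
sumBelow-0 zero = refl
sumBelow-0 (suc n) = trans (ℤ.+-identityˡ _) (sumBelow-0 n)

sumBelow-suc : ∀ n (g : ℕ → ℤ) → sumBelow g (suc n) ≡ sumBelow g n +ℤ g n
sumBelow-suc zero g = ℤ.+-comm (g 0) 0ℤ
sumBelow-suc (suc n) g = begin
  g 0 +ℤ sumBelow (g ∘ suc) (suc n)           ≡⟨ cong (g 0 +ℤ_) (sumBelow-suc n (g ∘ suc)) ⟩
  g 0 +ℤ (sumBelow (g ∘ suc) n +ℤ g (suc n))  ≡⟨ ℤ.+-assoc (g 0) _ _ ⟨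
  sumBelow g (suc n) +ℤ g (suc n)             ∎
  where open ≡-Reasoning

sumBelow-+ : ∀ n (g h : ℕ → ℤ) → sumBelow (λ j → g j +ℤ h j) n ≡ sumBelow g n +ℤ sumBelow h n
sumBelow-+ zero g h = refl
sumBelow-+ (suc n) g h
  rewrite sumBelow-+ n (g ∘ suc) (h ∘ suc) = interchange (g 0) (h 0) _ _
  where
  interchange : ∀ a b c d → a +ℤ b +ℤ (c +ℤ d) ≡ a +ℤ c +ℤ (b +ℤ d)
  interchange = solve-∀

sumBelow-neg : ∀ n (g : ℕ → ℤ) → sumBelow (λ j → -ℤ g j) n ≡ -ℤ sumBelow g n
sumBelow-neg zero g = refl
sumBelow-neg (suc n) g
  rewrite sumBelow-neg n (g ∘ suc) = sym (ℤ.neg-distrib-+ (g 0) _)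

*P-sumBelow : ∀ p q i → (p *P q) i ≡ sumBelow (λ j → p j *ℤ q (i ∸ j)) (suc i)
*P-sumBelow p q i = sumℤ-applyUpTo (λ j → p j *ℤ q (i ∸ j)) (λ j → j) (suc i)

*P-≡-sumBelow : ∀ p q i {t : ℕ → ℤ} → (∀ j → j ≤ i → p j *ℤ q (i ∸ j) ≡ t j) →
  (p *P q) i ≡ sumBelow t (suc i)
*P-≡-sumBelow p q i e =
  trans (*P-sumBelow p q i) (sumBelow-cong (suc i) (λ j j<1+i → e j (ℕ.≤-pred j<1+i)))

*P-cong-terms : ∀ {p q p′ q′} i → (∀ j → j ≤ i → p j *ℤ q (i ∸ j) ≡ p′ j *ℤ q′ (i ∸ j)) →
  (p *P q) i ≡ (p′ *P q′) i
*P-cong-terms {p} {q} {p′} {q′} i e = trans (*P-≡-sumBelow p q i e) (sym (*P-sumBelow p′ q′ i))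

*P-congˡ : ∀ p {q r} → q ≈ r → p *P q ≈ p *P r
*P-congˡ p {q} {r} q≈r i = *P-cong-terms {p} {q} {p} {r} i (λ j _ → cong (p j *ℤ_) (q≈r (i ∸ j)))

*P-congʳ : ∀ {p q} r → p ≈ q → p *P r ≈ q *P r
*P-congʳ {p} {q} r p≈q i = *P-cong-terms {p} {r} {q} {r} i (λ j _ → cong (_*ℤ r (i ∸ j)) (p≈q j))

+P-cong : ∀ {p p′ q q′} → p ≈ p′ → q ≈ q′ → p +P q ≈ p′ +P q′
+P-cong p≈p′ q≈q′ i = cong₂ _+ℤ_ (p≈p′ i) (q≈q′ i)

-P-cong : ∀ {p q} → p ≈ q → -P p ≈ -P q
-P-cong p≈q i = cong -ℤ_ (p≈q i)

*P-distribˡ-+P : ∀ p q r → p *P (q +P r) ≈ p *P q +P p *P r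
*P-distribˡ-+P p q r i = begin
  (p *P (q +P r)) i
    ≡⟨ *P-≡-sumBelow p (q +P r) i (λ j _ → ℤ.*-distribˡ-+ (p j) (q (i ∸ j)) (r (i ∸ j))) ⟩
  sumBelow (λ j → p j *ℤ q (i ∸ j) +ℤ p j *ℤ r (i ∸ j)) (suc i)
    ≡⟨ sumBelow-+ (suc i) (λ j → p j *ℤ q (i ∸ j)) (λ j → p j *ℤ r (i ∸ j)) ⟩
  sumBelow (λ j → p j *ℤ q (i ∸ j)) (suc i) +ℤ sumBelow (λ j → p j *ℤ r (i ∸ j)) (suc i)
    ≡⟨ cong₂ _+ℤ_ (*P-sumBelow p q i) (*P-sumBelow p r i) ⟨
  (p *P q +P p *P r) i ∎
  where open ≡-Reasoning

*P-distribʳ-+P : ∀ p q r → (p +P q) *P r ≈ p *P r +P q *P r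
*P-distribʳ-+P p q r i = begin
  ((p +P q) *P r) i
    ≡⟨ *P-≡-sumBelow (p +P q) r i (λ j _ → ℤ.*-distribʳ-+ (r (i ∸ j)) (p j) (q j)) ⟩
  sumBelow (λ j → p j *ℤ r (i ∸ j) +ℤ q j *ℤ r (i ∸ j)) (suc i)
    ≡⟨ sumBelow-+ (suc i) (λ j → p j *ℤ r (i ∸ j)) (λ j → q j *ℤ r (i ∸ j)) ⟩
  sumBelow (λ j → p j *ℤ r (i ∸ j)) (suc i) +ℤ sumBelow (λ j → q j *ℤ r (i ∸ j)) (suc i)
    ≡⟨ cong₂ _+ℤ_ (*P-sumBelow p r i) (*P-sumBelow q r i) ⟨
  (p *P r +P q *P r) i ∎
  where open ≡-Reasoning

-P-distribˡ-*P : ∀ p q → (-P p) *P q ≈ -P (p *P q)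
-P-distribˡ-*P p q i = begin
  ((-P p) *P q) i
    ≡⟨ *P-≡-sumBelow (-P p) q i (λ j _ → sym (ℤ.neg-distribˡ-* (p j) (q (i ∸ j)))) ⟩
  sumBelow (λ j → -ℤ (p j *ℤ q (i ∸ j))) (suc i)
    ≡⟨ sumBelow-neg (suc i) (λ j → p j *ℤ q (i ∸ j)) ⟩
  -ℤ sumBelow (λ j → p j *ℤ q (i ∸ j)) (suc i)
    ≡⟨ cong -ℤ_ (*P-sumBelow p q i) ⟨
  (-P (p *P q)) i ∎
  where open ≡-Reasoning

-P-distribʳ-*P : ∀ p q → p *P (-P q) ≈ -P (p *P q)
-P-distribʳ-*P p q i = begin
  (p *P (-P q)) i
    ≡⟨ *P-≡-sumBelow p (-P q) i (λ j _ → sym (ℤ.neg-distribʳ-* (p j) (q (i ∸ j)))) ⟩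
  sumBelow (λ j → -ℤ (p j *ℤ q (i ∸ j))) (suc i)
    ≡⟨ sumBelow-neg (suc i) (λ j → p j *ℤ q (i ∸ j)) ⟩
  -ℤ sumBelow (λ j → p j *ℤ q (i ∸ j)) (suc i)
    ≡⟨ cong -ℤ_ (*P-sumBelow p q i) ⟨
  (-P (p *P q)) i ∎
  where open ≡-Reasoning

oneP-∸ : ∀ {i j} → j < i → oneP (i ∸ j) ≡ 0ℤ
oneP-∸ {suc i} {j} (s≤s j≤i) = cong oneP (ℕ.+-∸-assoc 1 j≤i)

*P-identityʳ : ∀ p → p *P oneP ≈ p
*P-identityʳ p i = begin
  (p *P oneP) i                 ≡⟨ *P-sumBelow p oneP i ⟩
  sumBelow term (suc i)         ≡⟨ sumBelow-suc i term ⟩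
  sumBelow term i +ℤ term i     ≡⟨ cong₂ _+ℤ_ earlierTerms lastTerm ⟩
  0ℤ +ℤ p i *ℤ 1ℤ               ≡⟨ ℤ.+-identityˡ _ ⟩
  p i *ℤ 1ℤ                     ≡⟨ ℤ.*-identityʳ (p i) ⟩
  p i                           ∎
  where
  open ≡-Reasoning
  term : ℕ → ℤ
  term j = p j *ℤ oneP (i ∸ j)
  earlierTerms : sumBelow term i ≡ 0ℤ
  earlierTerms = trans (sumBelow-cong i (λ j j<i → trans (cong (p j *ℤ_) (oneP-∸ j<i)) (ℤ.*-zeroʳ (p j))))
                       (sumBelow-0 i)
  lastTerm : term i ≡ p i *ℤ 1ℤ
  lastTerm = cong (λ k → p i *ℤ oneP k) (ℕ.n∸n≡0 i)

*P-identityˡ : ∀ q → oneP *P q ≈ q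
*P-identityˡ q i = begin
  (oneP *P q) i                                         ≡⟨ *P-sumBelow oneP q i ⟩
  1ℤ *ℤ q i +ℤ sumBelow (λ _ → 0ℤ) i  ≡⟨ cong₂ _+ℤ_ (ℤ.*-identityˡ (q i)) (sumBelow-0 i) ⟩
  q i +ℤ 0ℤ                           ≡⟨ ℤ.+-identityʳ (q i) ⟩
  q i                                 ∎
  where open ≡-Reasoning

shift : Poly → Poly
shift p zero = 0ℤ
shift p (suc i) = p i

X^-suc : ∀ n → X^ (suc n) ≈ shift (X^ n)
X^-suc n zero = refl
X^-suc n (suc i) = refl

shift-cong : ∀ {p q} → p ≈ q → shift p ≈ shift q
shift-cong p≈q zero = refl
shift-cong p≈q (suc i) = p≈q i

shift-+P : ∀ p q → shift (p +P q) ≈ shift p +P shift q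
shift-+P p q zero = refl
shift-+P p q (suc i) = refl

shift-*P : ∀ p q → shift p *P q ≈ shift (p *P q)
shift-*P p q zero = refl
shift-*P p q (suc i) = begin
  (shift p *P q) (suc i)                              ≡⟨ *P-sumBelow (shift p) q (suc i) ⟩
  0ℤ +ℤ sumBelow (λ j → p j *ℤ q (i ∸ j)) (suc i)     ≡⟨ ℤ.+-identityˡ _ ⟩
  sumBelow (λ j → p j *ℤ q (i ∸ j)) (suc i)           ≡⟨ *P-sumBelow p q i ⟨
  (p *P q) i                                          ∎
  where open ≡-Reasoning

*P-shift : ∀ p q → p *P shift q ≈ shift (p *P q)
*P-shift p q zero = trans (ℤ.+-identityʳ _) (ℤ.*-zeroʳ (p 0))
*P-shift p q (suc i) = begin
  (p *P shift q) (suc i)                 ≡⟨ *P-sumBelow p (shift q) (suc i) ⟩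
  sumBelow term (suc (suc i))            ≡⟨ sumBelow-suc (suc i) term ⟩
  sumBelow term (suc i) +ℤ term (suc i)  ≡⟨ cong₂ _+ℤ_ (sumBelow-cong (suc i) earlierTerms) lastTerm ⟩
  sumBelow (λ j → p j *ℤ q (i ∸ j)) (suc i) +ℤ 0ℤ
                                         ≡⟨ ℤ.+-identityʳ _ ⟩
  sumBelow (λ j → p j *ℤ q (i ∸ j)) (suc i)
                                         ≡⟨ *P-sumBelow p q i ⟨
  (p *P q) i                             ∎
  where
  open ≡-Reasoning
  term : ℕ → ℤ
  term j = p j *ℤ shift q (suc i ∸ j)
  earlierTerms : ∀ j → j < suc i → term j ≡ p j *ℤ q (i ∸ j)
  earlierTerms j (s≤s j≤i) = cong (λ k → p j *ℤ shift q k) (ℕ.+-∸-assoc 1 j≤i)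
  lastTerm : term (suc i) ≡ 0ℤ
  lastTerm = trans (cong (λ k → p (suc i) *ℤ shift q k) (ℕ.n∸n≡0 i)) (ℤ.*-zeroʳ (p (suc i)))

X-*P : ∀ p → X^ 1 *P p ≈ shift p
X-*P p = begin
  X^ 1 *P p          ≈⟨ *P-congʳ p X≈shift-one ⟩
  shift oneP *P p    ≈⟨ shift-*P oneP p ⟩
  shift (oneP *P p)  ≈⟨ shift-cong (*P-identityˡ p) ⟩
  shift p            ∎
  where
  open ≈-Reasoning
  X≈shift-one : X^ 1 ≈ shift oneP
  X≈shift-one zero = refl
  X≈shift-one (suc i) = refl

twinPoly : Poly → Poly → Poly
twinPoly p q = p +P shift p +P -P shift q

twinPoly-shift : ∀ {p q} → p ≈ shift q → twinPoly p q ≈ shift p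
twinPoly-shift {p} {q} p≈xq i rewrite p≈xq i = cancel (shift q i) (shift p i)
  where
  cancel : ∀ a b → a +ℤ b +ℤ -ℤ a ≡ b
  cancel = solve-∀

twinPoly-split : ∀ {p q r} → p ≈ q +P r → p +P shift r ≈ twinPoly p q
twinPoly-split {p} {q} {r} p≈q+r i =
  trans (cancel (p i) (shift q i) (shift r i))
        (cong (λ s → p i +ℤ s +ℤ -ℤ shift q i) (sym (trans (shift-cong p≈q+r i) (shift-+P q r i))))
  where
  cancel : ∀ a b c → a +ℤ c ≡ a +ℤ (b +ℤ c) +ℤ -ℤ b
  cancel = solve-∀

twinPoly-cong : ∀ {p p′ q q′} → p ≈ p′ → q ≈ q′ → twinPoly p q ≈ twinPoly p′ q′
twinPoly-cong p≈p′ q≈q′ = +P-cong (+P-cong p≈p′ (shift-cong p≈p′)) (-P-cong (shift-cong q≈q′))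

sumP-cong : ∀ {V : Set} (L : List V) {F F′ : V → Poly} → (∀ v → F v ≈ F′ v) →
  sumP (mapL F L) ≈ sumP (mapL F′ L)
sumP-cong [] F≈F′ i = refl
sumP-cong (v ∷ L) F≈F′ = +P-cong (F≈F′ v) (sumP-cong L F≈F′)

sumP-twinPoly : ∀ {V : Set} (L : List V) (a b : V → Poly) →
  sumP (mapL (λ v → twinPoly (a v) (b v)) L) ≈ twinPoly (sumP (mapL a L)) (sumP (mapL b L))
sumP-twinPoly [] a b zero = refl
sumP-twinPoly [] a b (suc i) = refl
sumP-twinPoly (v ∷ L) a b i
  rewrite sumP-twinPoly L a b i
        | shift-+P (a v) (sumP (mapL a L)) i | shift-+P (b v) (sumP (mapL b L)) i =
  rearrange (a v i) (shift (a v) i) (shift (b v) i)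
            (sumP (mapL a L) i) (shift (sumP (mapL a L)) i) (shift (sumP (mapL b L)) i)
  where
  rearrange : ∀ a xa xb A xA xB →
    a +ℤ xa +ℤ -ℤ xb +ℤ (A +ℤ xA +ℤ -ℤ xB) ≡ a +ℤ A +ℤ (xa +ℤ xA) +ℤ -ℤ (xb +ℤ xB)
  rearrange = solve-∀

sumP-concatMap-pairs : ∀ {m} (L : List (Vec Bool m)) (F : Vec Bool (suc m) → Poly) →
  sumP (mapL F (concatMap (λ v → (false ∷ v) ∷ (true ∷ v) ∷ []) L))
    ≈ sumP (mapL (λ v → F (false ∷ v) +P F (true ∷ v)) L)
sumP-concatMap-pairs [] F i = refl
sumP-concatMap-pairs (v ∷ L) F i
  rewrite sumP-concatMap-pairs L F i = sym (ℤ.+-assoc (F (false ∷ v) i) _ _)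

*P-pℓ : ∀ p q r → p *P (pℓ false *P r) +P q *P (pℓ true *P r) ≈ twinPoly (q *P r) (p *P r)
*P-pℓ p q r = begin
  p *P (pℓ false *P r) +P q *P (pℓ true *P r)  ≈⟨ +P-cong p-part q-part ⟩
  -P shift (p *P r) +P (q *P r +P shift (q *P r))
                                              ≈⟨ (λ i → ℤ.+-comm (-ℤ shift (p *P r) i) _) ⟩
  twinPoly (q *P r) (p *P r)                  ∎
  where
  open ≈-Reasoning
  p-part : p *P (pℓ false *P r) ≈ -P shift (p *P r)
  p-part = begin
    p *P ((-P X^ 1) *P r)  ≈⟨ *P-congˡ p (-P-distribˡ-*P (X^ 1) r) ⟩
    p *P (-P (X^ 1 *P r))  ≈⟨ *P-congˡ p (-P-cong (X-*P r)) ⟩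
    p *P (-P shift r)      ≈⟨ -P-distribʳ-*P p (shift r) ⟩
    -P (p *P shift r)      ≈⟨ -P-cong (*P-shift p r) ⟩
    -P shift (p *P r)      ∎
  q-part : q *P (pℓ true *P r) ≈ q *P r +P shift (q *P r)
  q-part = begin
    q *P ((oneP +P X^ 1) *P r)      ≈⟨ *P-congˡ q (*P-distribʳ-+P oneP (X^ 1) r) ⟩
    q *P (oneP *P r +P X^ 1 *P r)   ≈⟨ *P-congˡ q (+P-cong (*P-identityˡ r) (X-*P r)) ⟩
    q *P (r +P shift r)             ≈⟨ *P-distribˡ-+P q r (shift r) ⟩
    q *P r +P q *P shift r          ≈⟨ +P-cong (≈-refl {q *P r}) (*P-shift q r) ⟩
    q *P r +P shift (q *P r)        ∎

-- Graphs, pivots and isomorphisms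

∧-swap-pairs : ∀ a b c d {e e′} → e ≡ e′ → a ∧ b ∧ c ∧ d ∧ e ≡ b ∧ a ∧ d ∧ c ∧ e′
∧-swap-pairs false false c d refl = refl
∧-swap-pairs false true c d refl = refl
∧-swap-pairs true false c d refl = refl
∧-swap-pairs true true false false refl = refl
∧-swap-pairs true true false true refl = refl
∧-swap-pairs true true true false refl = refl
∧-swap-pairs true true true true refl = refl

==-refl : ∀ {n} (x : Fin n) → (x == x) ≡ true
==-refl x = trans (isYes≗does (x ≟ᶠ x)) (dec-true (x ≟ᶠ x) refl)

==-≢ : ∀ {n} {x y : Fin n} → x ≢ y → (x == y) ≡ false
==-≢ {x = x} {y} x≢y = trans (isYes≗does (x ≟ᶠ y)) (dec-false (x ≟ᶠ y) x≢y)

==-injective : ∀ {n n′} (f : Fin n → Fin n′) → (∀ {x y} → f x ≡ f y → x ≡ y) →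
  ∀ x y → (f x == f y) ≡ (x == y)
==-injective f f-inj x y with x ≟ᶠ y
... | yes refl = ==-refl (f x)
... | no x≢y = ==-≢ (x≢y ∘ f-inj)

==-suc : ∀ {n} (x y : Fin n) → (suc x == suc y) ≡ (x == y)
==-suc = ==-injective suc Fin.suc-injective

relabel : ∀ {n m} → (Fin m → Fin n) → Adj n → Adj m
relabel f G x y = G (f x) (f y)

Simple-relabel : ∀ {n m} {G : Adj n} (f : Fin m → Fin n) → Simple G → Simple (relabel f G)
Simple-relabel f (sym , irrefl) = (λ x y → sym (f x) (f y)) , (λ x → irrefl (f x))

Simple-delete : ∀ {n} {G : Adj (suc n)} a → Simple G → Simple (delete G a)
Simple-delete a = Simple-relabel (punchIn a)

pivot-sym : ∀ {n} (G : Adj n) a b x y → G x y ≡ G y x → pivot G a b x y ≡ pivot G a b y x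
pivot-sym G a b x y Gxy≡Gyx = cong₂ _xor_ Gxy≡Gyx
  (∧-swap-pairs (not (x == a) ∧ not (x == b)) (not (y == a) ∧ not (y == b)) (G a x ∨ G b x) (G a y ∨ G b y)
    (cong₂ _∨_ (xor-comm (G a x) (G a y)) (xor-comm (G b x) (G b y))))

pivot-irrefl : ∀ {n} (G : Adj n) a b x → G x x ≡ false → pivot G a b x x ≡ false
pivot-irrefl G a b x Gxx≡false
  rewrite Gxx≡false | xor-same (G a x) | xor-same (G b x)
        | ∧-zeroʳ (G a x ∨ G b x) | ∧-zeroʳ (G a x ∨ G b x)
        | ∧-zeroʳ (not (x == a) ∧ not (x == b)) | ∧-zeroʳ (not (x == a) ∧ not (x == b)) = refl

Simple-pivot : ∀ {n} {G : Adj n} a b → Simple G → Simple (pivot G a b)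
Simple-pivot {G = G} a b (sym , irrefl) =
  (λ x y → pivot-sym G a b x y (sym x y)) , (λ x → pivot-irrefl G a b x (irrefl x))

-- An isolated vertex lies in none of the classes (1)–(3), so the pivot creates no edge at it.
pivot-isolated : ∀ {n} {G : Adj n} a b z → Simple G → (∀ y → G z y ≡ false) →
  ∀ y → pivot G a b z y ≡ false
pivot-isolated {G = G} a b z (sym , _) z-isolated y
  rewrite z-isolated y | trans (sym a z) (z-isolated a) | trans (sym b z) (z-isolated b)
        | ∧-zeroʳ (not (y == a) ∧ not (y == b)) | ∧-zeroʳ (not (z == a) ∧ not (z == b)) = refl

Edgeless : ∀ {n} → Adj n → Set
Edgeless {n} G = ∀ (a b : Fin n) → G a b ≡ false

edgeOrEdgeless : ∀ {n} (G : Adj n) → (∃₂ λ a b → G a b ≡ true) ⊎ Edgeless G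
edgeOrEdgeless G with any? (λ a → any? (λ b → G a b Bool.≟ true))
... | yes (a , b , ab) = inj₁ (a , b , ab)
... | no noEdge = inj₂ (λ a b → ¬-not (λ ab → noEdge (a , b , ab)))

infix 4 _≅[_]_

_≅[_]_ : ∀ {n n′} → Adj n → Permutation n n′ → Adj n′ → Set
G ≅[ π ] H = ∀ i j → H (π ⟨$⟩ʳ i) (π ⟨$⟩ʳ j) ≡ G i j

permutation-injective : ∀ {n n′} (π : Permutation n n′) {x y} → π ⟨$⟩ʳ x ≡ π ⟨$⟩ʳ y → x ≡ y
permutation-injective π = Injection.injective (↔⇒↣ π)

≅-Edgeless : ∀ {n n′} {G : Adj n} {H : Adj n′} (π : Permutation n n′) →
  G ≅[ π ] H → Edgeless G → Edgeless H
≅-Edgeless {H = H} π G≅H edgeless a b =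
  trans (sym (cong₂ H (inverseʳ π) (inverseʳ π))) (trans (G≅H _ _) (edgeless _ _))

≅-delete : ∀ {n n′} {G : Adj (suc n)} {H : Adj (suc n′)} (π : Permutation (suc n) (suc n′)) a →
  G ≅[ π ] H → delete G a ≅[ remove a π ] delete H (π ⟨$⟩ʳ a)
≅-delete {H = H} π a G≅H i j =
  trans (sym (cong₂ H (punchIn-permute π a i) (punchIn-permute π a j))) (G≅H _ _)

≅-pivot : ∀ {n n′} {G : Adj n} {H : Adj n′} (π : Permutation n n′) a b →
  G ≅[ π ] H → pivot G a b ≅[ π ] pivot H (π ⟨$⟩ʳ a) (π ⟨$⟩ʳ b)
≅-pivot π a b G≅H x y
  rewrite G≅H x y | G≅H a x | G≅H a y | G≅H b x | G≅H b y
        | ==-injective (π ⟨$⟩ʳ_) (permutation-injective π) x a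
        | ==-injective (π ⟨$⟩ʳ_) (permutation-injective π) x b
        | ==-injective (π ⟨$⟩ʳ_) (permutation-injective π) y a
        | ==-injective (π ⟨$⟩ʳ_) (permutation-injective π) y b = refl

pivot-delete₀ : ∀ {n} (K : Adj (suc n)) c d x y →
  pivot K (suc c) (suc d) (suc x) (suc y) ≡ pivot (delete K zero) c d x y
pivot-delete₀ K c d x y rewrite ==-suc x c | ==-suc x d | ==-suc y c | ==-suc y d = refl

mergeTwins₀ : ∀ {n} → Fin (suc (suc n)) → Fin (suc n)
mergeTwins₀ zero = zero
mergeTwins₀ (suc j) = j

addTwin₀ : ∀ {n} → Adj (suc n) → Adj (suc (suc n))
addTwin₀ = relabel mergeTwins₀

-- For the pivot on the edge 1b, vertex 0 is in class (2), while every other neighbour of 0 is adjacent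
-- to its twin 1 and hence in class (1) or (3); so the pivot removes all edges at 0 except 0b.
pivot-addTwin₀ : ∀ {n} (H : Adj (suc n)) w → H zero zero ≡ false → H (suc w) zero ≡ true →
  ∀ y → y ≢ suc (suc w) → pivot (addTwin₀ H) (suc zero) (suc (suc w)) zero y ≡ false
pivot-addTwin₀ H w H00≡false Hw0≡true zero _ rewrite H00≡false | Hw0≡true = refl
pivot-addTwin₀ H w H00≡false Hw0≡true (suc zero) _ rewrite H00≡false = refl
pivot-addTwin₀ H w H00≡false Hw0≡true (suc (suc k)) k≢w
  rewrite H00≡false | Hw0≡true | ==-≢ k≢w = cancel (H zero (suc k)) (H (suc w) (suc k))
  where
  cancel : ∀ α β → α xor ((α ∨ β) ∧ (α ∨ not β)) ≡ false
  cancel false false = refl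
  cancel false true = refl
  cancel true false = refl
  cancel true true = refl

-- Substitution

Simple-[] : ∀ {n} {G : Adj n} (k : Vec ℕ n) → Simple G → Simple (G [ k ])
Simple-[] k = Simple-relabel (owner k)

owner-inj₁ : ∀ {n} k₀ (ks : Vec ℕ n) {j x} → splitAt k₀ j ≡ inj₁ x → owner (k₀ ∷ ks) j ≡ zero
owner-inj₁ k₀ ks {j} eq with splitAt k₀ j
owner-inj₁ k₀ ks refl | _ = refl

owner-inj₂ : ∀ {n} k₀ (ks : Vec ℕ n) {j y} → splitAt k₀ j ≡ inj₂ y →
  owner (k₀ ∷ ks) j ≡ suc (owner ks y)
owner-inj₂ k₀ ks {j} eq with splitAt k₀ j
owner-inj₂ k₀ ks refl | _ = refl

owner-mergeTwins₀ : ∀ {n} (k : Vec ℕ n) x → owner (1 ∷ k) (mergeTwins₀ x) ≡ owner (2 ∷ k) x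
owner-mergeTwins₀ k zero = refl
owner-mergeTwins₀ k (suc zero) = refl
owner-mergeTwins₀ k (suc (suc x)) = refl

-- Moves vertex s to position 0, shifting the vertices before it up by one.
toFront : ∀ s {r} → Fin (s + suc r) → Fin (suc (s + r))
toFront zero i = i
toFront (suc s) zero = suc zero
toFront (suc s) (suc i) = punchIn (suc zero) (toFront s i)

module BlockToFront (e : ℕ) {r : ℕ} (t : Vec ℕ r) where

  skipBlock : ∀ p {S} → Fin (e + S) → Fin (e + (p + S))
  skipBlock p {S} z = [ (λ u → u ↑ˡ (p + S)) , (λ v → e ↑ʳ (p ↑ʳ v)) ]′ (splitAt e z)

  blockToFront : ∀ {s} (pre : Vec ℕ s) → Fin (sum (pre ++ e ∷ t)) → Fin (e + sum (pre ++ t))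
  blockToFront [] i = i
  blockToFront (p ∷ pre) i =
    [ (λ x → e ↑ʳ (x ↑ˡ sum (pre ++ t))) , (λ y → skipBlock p (blockToFront pre y)) ]′ (splitAt p i)

  blockToFront⁻¹ : ∀ {s} (pre : Vec ℕ s) → Fin (e + sum (pre ++ t)) → Fin (sum (pre ++ e ∷ t))
  blockToFront⁻¹ [] z = z
  blockToFront⁻¹ (p ∷ pre) z =
    [ (λ u → p ↑ʳ blockToFront⁻¹ pre (u ↑ˡ sum (pre ++ t)))
    , (λ z′ → [ (λ x → x ↑ˡ sum (pre ++ e ∷ t)) , (λ v → p ↑ʳ blockToFront⁻¹ pre (e ↑ʳ v)) ]′
                (splitAt p z′))
    ]′ (splitAt e z)

  blockToFront⁻¹-blockToFront : ∀ {s} (pre : Vec ℕ s) i → blockToFront⁻¹ pre (blockToFront pre i) ≡ i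
  blockToFront⁻¹-blockToFront [] i = refl
  blockToFront⁻¹-blockToFront (p ∷ pre) i with splitAt p i in eq
  ... | inj₁ x rewrite splitAt-↑ʳ e (p + sum (pre ++ t)) (x ↑ˡ sum (pre ++ t))
                     | splitAt-↑ˡ p x (sum (pre ++ t)) = splitAt⁻¹-↑ˡ eq
  ... | inj₂ y with splitAt e (blockToFront pre y) in eq₂
  ...   | inj₁ u rewrite splitAt-↑ˡ e u (p + sum (pre ++ t))
                       | splitAt⁻¹-↑ˡ eq₂ | blockToFront⁻¹-blockToFront pre y = splitAt⁻¹-↑ʳ eq
  ...   | inj₂ v rewrite splitAt-↑ʳ e (p + sum (pre ++ t)) (p ↑ʳ v)
                       | splitAt-↑ʳ p (sum (pre ++ t)) v
                       | splitAt⁻¹-↑ʳ eq₂ | blockToFront⁻¹-blockToFront pre y = splitAt⁻¹-↑ʳ eq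

  blockToFront-blockToFront⁻¹ : ∀ {s} (pre : Vec ℕ s) z → blockToFront pre (blockToFront⁻¹ pre z) ≡ z
  blockToFront-blockToFront⁻¹ [] z = refl
  blockToFront-blockToFront⁻¹ (p ∷ pre) z with splitAt e z in eq
  ... | inj₁ u rewrite splitAt-↑ʳ p (sum (pre ++ e ∷ t)) (blockToFront⁻¹ pre (u ↑ˡ sum (pre ++ t)))
                     | blockToFront-blockToFront⁻¹ pre (u ↑ˡ sum (pre ++ t))
                     | splitAt-↑ˡ e u (sum (pre ++ t)) = splitAt⁻¹-↑ˡ eq
  ... | inj₂ z′ with splitAt p z′ in eq₂
  ...   | inj₁ x rewrite splitAt-↑ˡ p x (sum (pre ++ e ∷ t)) | splitAt⁻¹-↑ˡ eq₂ = splitAt⁻¹-↑ʳ eq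
  ...   | inj₂ v rewrite splitAt-↑ʳ p (sum (pre ++ e ∷ t)) (blockToFront⁻¹ pre (e ↑ʳ v))
                       | blockToFront-blockToFront⁻¹ pre (e ↑ʳ v)
                       | splitAt-↑ʳ e (sum (pre ++ t)) v
                       | splitAt⁻¹-↑ʳ eq₂ = splitAt⁻¹-↑ʳ eq

  blockToFront-permutation : ∀ {s} (pre : Vec ℕ s) → Permutation (sum (pre ++ e ∷ t)) (e + sum (pre ++ t))
  blockToFront-permutation pre =
    permutation (blockToFront pre) (blockToFront⁻¹ pre)
                (blockToFront-blockToFront⁻¹ pre) (blockToFront⁻¹-blockToFront pre)

  owner-blockToFront : ∀ {s} (pre : Vec ℕ s) i →
    owner (e ∷ pre ++ t) (blockToFront pre i) ≡ toFront s (owner (pre ++ e ∷ t) i)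
  owner-blockToFront [] i = refl
  owner-blockToFront (p ∷ pre) i with splitAt p i
  ... | inj₁ x rewrite owner-inj₂ e (p ∷ pre ++ t) (splitAt-↑ʳ e _ (x ↑ˡ sum (pre ++ t)))
                     | owner-inj₁ p (pre ++ t) (splitAt-↑ˡ p x (sum (pre ++ t))) = refl
  ... | inj₂ y rewrite sym (owner-blockToFront pre y)
    with splitAt e (blockToFront pre y) in eq₂
  ...   | inj₁ u rewrite owner-inj₁ e (p ∷ pre ++ t) (splitAt-↑ˡ e u (p + sum (pre ++ t))) = refl
  ...   | inj₂ v rewrite owner-inj₂ e (p ∷ pre ++ t) (splitAt-↑ʳ e (p + sum (pre ++ t)) (p ↑ʳ v))
                       | owner-inj₂ p (pre ++ t) (splitAt-↑ʳ p (sum (pre ++ t)) v) = refl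

  ≅-blockToFront : ∀ {s} (pre : Vec ℕ s) (G : Adj (suc (s + r))) →
    relabel (toFront s) G [ pre ++ e ∷ t ] ≅[ blockToFront-permutation pre ] G [ e ∷ pre ++ t ]
  ≅-blockToFront pre G i j = cong₂ G (owner-blockToFront pre i) (owner-blockToFront pre j)

-- Consequences of the recursion

module Interlace (Q : ∀ {n} → Adj n → Poly) (isInterlace : IsInterlace Q) where

  Q-edgeless : ∀ n (G : Adj n) → Simple G → Edgeless G → Q G ≈ X^ n
  Q-edgeless = proj₁ isInterlace

  Q-edge : ∀ n (G : Adj (suc n)) → Simple G → (a b : Fin (suc n)) → G a b ≡ true →
    Q G ≈ Q (delete G a) +P Q (delete (pivot G a b) b)
  Q-edge = proj₂ isInterlace

  Q-≅-Edgeless : ∀ {n n′} {G : Adj n} {H : Adj n′} (π : Permutation n n′) → Simple G → Simple H →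
    G ≅[ π ] H → Edgeless G → Q G ≈ Q H
  Q-≅-Edgeless {n} {n′} {G} {H} π sG sH G≅H edgeless i = begin
    Q G i    ≡⟨ Q-edgeless n G sG edgeless i ⟩
    X^ n i   ≡⟨ cong (λ k → X^ k i) (↔⇒≡ π) ⟩
    X^ n′ i  ≡⟨ Q-edgeless n′ H sH (≅-Edgeless π G≅H edgeless) i ⟨
    Q H i    ∎
    where open ≡-Reasoning

  Q-≅ : ∀ {n n′} {G : Adj n} {H : Adj n′} (π : Permutation n n′) → Simple G → Simple H →
    G ≅[ π ] H → Q G ≈ Q H
  Q-≅ {zero} π sG sH G≅H = Q-≅-Edgeless π sG sH G≅H (λ ())
  Q-≅ {suc n} {zero} π sG sH G≅H with () ← π ⟨$⟩ʳ zero
  Q-≅ {suc n} {suc n′} {G} {H} π sG sH G≅H with edgeOrEdgeless G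
  ... | inj₂ edgeless = Q-≅-Edgeless π sG sH G≅H edgeless
  ... | inj₁ (a , b , ab) = begin
    Q G                                                ≈⟨ Q-edge n G sG a b ab ⟩
    Q (delete G a) +P Q (delete (pivot G a b) b)       ≈⟨ +P-cong deleted pivoted ⟩
    Q (delete H πa) +P Q (delete (pivot H πa πb) πb)   ≈⟨ Q-edge n′ H sH πa πb (trans (G≅H a b) ab) ⟨
    Q H                                                ∎
    where
    open ≈-Reasoning
    πa πb : Fin (suc n′)
    πa = π ⟨$⟩ʳ a
    πb = π ⟨$⟩ʳ b
    deleted : Q (delete G a) ≈ Q (delete H πa)
    deleted = Q-≅ (remove a π) (Simple-delete a sG) (Simple-delete πa sH) (≅-delete {G = G} {H} π a G≅H)
    pivoted : Q (delete (pivot G a b) b) ≈ Q (delete (pivot H πa πb) πb)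
    pivoted = Q-≅ (remove b π)
      (Simple-delete b (Simple-pivot a b sG)) (Simple-delete πb (Simple-pivot πa πb sH))
      (≅-delete {G = pivot G a b} {pivot H πa πb} π b (≅-pivot {G = G} {H} π a b G≅H))

  Q-cong : ∀ {n} {G H : Adj n} → Simple G → Simple H → (∀ i j → H i j ≡ G i j) → Q G ≈ Q H
  Q-cong = Q-≅ Permutation.id

  Q-isolated₀ : ∀ {n} {K : Adj (suc n)} → Simple K → (∀ j → K zero j ≡ false) →
    Q K ≈ shift (Q (delete K zero))
  Q-isolated₀ {n} {K} sK 0-isolated with edgeOrEdgeless (delete K zero)
  ... | inj₂ edgeless = begin
    Q K                      ≈⟨ Q-edgeless (suc n) K sK K-edgeless ⟩
    X^ (suc n)               ≈⟨ X^-suc n ⟩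
    shift (X^ n)             ≈⟨ shift-cong (Q-edgeless n (delete K zero) (Simple-delete zero sK) edgeless) ⟨
    shift (Q (delete K zero)) ∎
    where
    open ≈-Reasoning
    K-edgeless : Edgeless K
    K-edgeless zero b = 0-isolated b
    K-edgeless (suc a) zero = trans (proj₁ sK (suc a) zero) (0-isolated (suc a))
    K-edgeless (suc a) (suc b) = edgeless a b
  Q-isolated₀ {suc n} {K} sK 0-isolated | inj₁ (c , d , cd) = begin
    Q K                                           ≈⟨ Q-edge (suc n) K sK (suc c) (suc d) cd ⟩
    Q K₁ +P Q K₂                                  ≈⟨ +P-cong (Q-isolated₀ sK₁ (0-isolated ∘ punchIn (suc c)))
                                                                  (Q-isolated₀ sK₂ K₂-0-isolated) ⟩
    shift (Q (delete K₁ zero)) +P shift (Q (delete K₂ zero))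
                                                  ≈⟨ shift-+P _ _ ⟨
    shift (Q (delete K₀ c) +P Q (delete K₂ zero)) ≈⟨ shift-cong (+P-cong (≈-refl {Q (delete K₀ c)}) K₂-0≈K₀′) ⟩
    shift (Q (delete K₀ c) +P Q K₀′)              ≈⟨ shift-cong (Q-edge n K₀ sK₀ c d cd) ⟨
    shift (Q K₀)                                  ∎
    where
    open ≈-Reasoning
    K₀ K₁ K₂ : Adj (suc n)
    K₀ = delete K zero
    K₁ = delete K (suc c)
    K₂ = delete (pivot K (suc c) (suc d)) (suc d)
    K₀′ : Adj n
    K₀′ = delete (pivot K₀ c d) d
    sK₀ : Simple K₀
    sK₀ = Simple-delete zero sK
    sK₁ : Simple K₁
    sK₁ = Simple-delete (suc c) sK
    sK₂ : Simple K₂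
    sK₂ = Simple-delete (suc d) (Simple-pivot (suc c) (suc d) sK)
    sK₀′ : Simple K₀′
    sK₀′ = Simple-delete d (Simple-pivot c d sK₀)
    K₂-0-isolated : ∀ j → K₂ zero j ≡ false
    K₂-0-isolated j = pivot-isolated (suc c) (suc d) zero sK 0-isolated (punchIn (suc d) j)
    K₂-0≈K₀′ : Q (delete K₂ zero) ≈ Q K₀′
    K₂-0≈K₀′ = Q-cong (Simple-delete zero sK₂) sK₀′
      (λ x y → sym (pivot-delete₀ K c d (punchIn d x) (punchIn d y)))

  Q-addTwin₀ : ∀ {n} {H : Adj (suc n)} → Simple H → Q (addTwin₀ H) ≈ twinPoly (Q H) (Q (delete H zero))
  Q-addTwin₀ {n} {H} sH with any? (λ j → H zero j Bool.≟ true)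
  ... | no 0-unmatched = begin
    Q (addTwin₀ H)  ≈⟨ Q-isolated₀ sD (0-isolated ∘ mergeTwins₀) ⟩
    shift (Q H)     ≈⟨ twinPoly-shift (Q-isolated₀ sH 0-isolated) ⟨
    twinPoly (Q H) (Q (delete H zero)) ∎
    where
    open ≈-Reasoning
    sD : Simple (addTwin₀ H)
    sD = Simple-relabel mergeTwins₀ sH
    0-isolated : ∀ j → H zero j ≡ false
    0-isolated j = ¬-not (λ H0j → 0-unmatched (j , H0j))
  ... | yes (zero , H00) = contradiction (trans (sym H00) (proj₂ sH zero)) λ ()
  ... | yes (suc w , H0w) = begin
    Q (addTwin₀ H)                     ≈⟨ Q-edge (suc n) (addTwin₀ H) sD (suc zero) b H0w ⟩
    Q (delete (addTwin₀ H) (suc zero)) +P Q K₂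
                                       ≈⟨ +P-cong D-1≈H (Q-isolated₀ sK₂ K₂-0-isolated) ⟩
    Q H +P shift (Q (delete K₂ zero))  ≈⟨ +P-cong (≈-refl {Q H}) (shift-cong K₂-0≈H′) ⟩
    Q H +P shift (Q H′)                ≈⟨ twinPoly-split (Q-edge n H sH zero (suc w) H0w) ⟩
    twinPoly (Q H) (Q (delete H zero)) ∎
    where
    open ≈-Reasoning
    b : Fin (suc (suc n))
    b = suc (suc w)
    K₂ : Adj (suc n)
    K₂ = delete (pivot (addTwin₀ H) (suc zero) b) b
    H′ : Adj n
    H′ = delete (pivot H zero (suc w)) (suc w)
    sD : Simple (addTwin₀ H)
    sD = Simple-relabel mergeTwins₀ sH
    sK₂ : Simple K₂
    sK₂ = Simple-delete b (Simple-pivot (suc zero) b sD)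
    sH′ : Simple H′
    sH′ = Simple-delete (suc w) (Simple-pivot zero (suc w) sH)
    merge-punchIn₁ : ∀ x → mergeTwins₀ (punchIn (suc zero) x) ≡ x
    merge-punchIn₁ zero = refl
    merge-punchIn₁ (suc x) = refl
    D-1≈H : Q (delete (addTwin₀ H) (suc zero)) ≈ Q H
    D-1≈H = Q-cong (Simple-delete (suc zero) sD) sH
      (λ x y → sym (cong₂ H (merge-punchIn₁ x) (merge-punchIn₁ y)))
    K₂-0-isolated : ∀ j → K₂ zero j ≡ false
    K₂-0-isolated j = pivot-addTwin₀ H w (proj₂ sH zero) (trans (proj₁ sH (suc w) zero) H0w)
                        (punchIn b j) (Fin.punchInᵢ≢i b j)
    K₂-0≈H′ : Q (delete K₂ zero) ≈ Q H′
    K₂-0≈H′ = Q-cong (Simple-delete zero sK₂) sH′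
      (λ x y → sym (pivot-delete₀ (addTwin₀ H) zero (suc w) (punchIn (suc w) x) (punchIn (suc w) y)))

  Q-blockToFront : ∀ {s r} (pre : Vec ℕ s) e (t : Vec ℕ r) (G : Adj (suc (s + r))) → Simple G →
    Q (relabel (toFront s) G [ pre ++ e ∷ t ]) ≈ Q (G [ e ∷ pre ++ t ])
  Q-blockToFront {s} pre e t G sG =
    Q-≅ (blockToFront-permutation pre) (Simple-[] (pre ++ e ∷ t) (Simple-relabel (toFront s) sG))
        (Simple-[] (e ∷ pre ++ t) sG) (≅-blockToFront pre G)
    where open BlockToFront e t

  Q-[2∷] : ∀ {n} (k : Vec ℕ n) (G : Adj (suc n)) → Simple G →
    Q (G [ 2 ∷ k ]) ≈ twinPoly (Q (G [ 1 ∷ k ])) (Q (delete G zero [ k ]))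
  Q-[2∷] k G sG = begin
    Q (G [ 2 ∷ k ])              ≈⟨ Q-cong (Simple-[] (2 ∷ k) sG) (Simple-relabel mergeTwins₀ (Simple-[] (1 ∷ k) sG))
                                          (λ x y → cong₂ G (owner-mergeTwins₀ k x) (owner-mergeTwins₀ k y)) ⟩
    Q (addTwin₀ (G [ 1 ∷ k ]))   ≈⟨ Q-addTwin₀ (Simple-[] (1 ∷ k) sG) ⟩
    twinPoly (Q (G [ 1 ∷ k ])) (Q (delete G zero [ k ])) ∎
    where open ≈-Reasoning

  Q-double-prefix : ∀ m {r} (t : Vec ℕ r) (G : Adj (m + r)) → Simple G →
    Q (G [ replicate m 2 ++ t ]) ≈ sumP (mapL (λ ℓ → Q (G [ map bitℕ ℓ ++ t ]) *P prodPℓ ℓ) (allBools m))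
  Q-double-prefix zero t G sG i = sym (trans (ℤ.+-identityʳ _) (*P-identityʳ (Q (G [ t ])) i))
  Q-double-prefix (suc m) {r} t G sG = begin
    Q (G [ 2 ∷ w ])                                       ≈⟨ Q-[2∷] w G sG ⟩
    twinPoly (Q (G [ 1 ∷ w ])) (Q (delete G zero [ w ]))  ≈⟨ twinPoly-cong kept deleted ⟩
    twinPoly (sumP (mapL a L)) (sumP (mapL b L))          ≈⟨ sumP-twinPoly L a b ⟨
    sumP (mapL (λ v → twinPoly (a v) (b v)) L)            ≈⟨ sumP-cong L weights ⟨
    sumP (mapL (λ v → F (false ∷ v) +P F (true ∷ v)) L)   ≈⟨ sumP-concatMap-pairs L F ⟨
    sumP (mapL F (allBools (suc m)))                      ∎
    where
    open ≈-Reasoning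
    w : Vec ℕ (m + r)
    w = replicate m 2 ++ t
    L : List (Vec Bool m)
    L = allBools m
    ℓ⁺ : Vec Bool m → Vec ℕ (m + r)
    ℓ⁺ v = map bitℕ v ++ t
    F : Vec Bool (suc m) → Poly
    F ℓ = Q (G [ map bitℕ ℓ ++ t ]) *P prodPℓ ℓ
    a b : Vec Bool m → Poly
    a v = Q (G [ 1 ∷ ℓ⁺ v ]) *P prodPℓ v
    b v = Q (delete G zero [ ℓ⁺ v ]) *P prodPℓ v
    weights : ∀ v → F (false ∷ v) +P F (true ∷ v) ≈ twinPoly (a v) (b v)
    weights v = *P-pℓ (Q (delete G zero [ ℓ⁺ v ])) (Q (G [ 1 ∷ ℓ⁺ v ])) (prodPℓ v)
    -- The induction hypothesis needs the remaining single copy behind the block of doubled vertices.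
    G′ : Adj (m + suc r)
    G′ = relabel (toFront m) G
    kept : Q (G [ 1 ∷ w ]) ≈ sumP (mapL a L)
    kept = begin
      Q (G [ 1 ∷ w ])                                       ≈⟨ Q-blockToFront (replicate m 2) 1 t G sG ⟨
      Q (G′ [ replicate m 2 ++ 1 ∷ t ])
        ≈⟨ Q-double-prefix m (1 ∷ t) G′ (Simple-relabel (toFront m) sG) ⟩
      sumP (mapL (λ v → Q (G′ [ map bitℕ v ++ 1 ∷ t ]) *P prodPℓ v) L)
        ≈⟨ sumP-cong L (λ v → *P-congʳ (prodPℓ v) (Q-blockToFront (map bitℕ v) 1 t G sG)) ⟩
      sumP (mapL a L)                                       ∎
    deleted : Q (delete G zero [ w ]) ≈ sumP (mapL b L)
    deleted = Q-double-prefix m t (delete G zero) (Simple-delete zero sG)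

open Interlace using (Q-double-prefix)

proposition41 : (Q : ∀ {n} → Adj n → Poly) → IsInterlace Q →
    (m r : ℕ) → 1 ≤ m → (G : Adj (m + r)) → Simple G →
    Q (G [ replicate m 2 ++ replicate r 1 ])
      ≈ sumP (mapL (λ ℓ → Q (G [ map bitℕ ℓ ++ replicate r 1 ]) *P prodPℓ ℓ)
                   (allBools m))
proposition41 Q isInterlace m r _ G sG = Q-double-prefix Q isInterlace m (replicate r 1) G sG
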